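{- Let $\varphi$ be the morphism on the alphabet $\{0, 1, 0', -1\}$ defined by $$0 \mapsto 0\,1\,0'\,{ -1},\quad 1 \mapsto 0\,1\,{ -1}\,1,\quad 0' \mapsto 0'\,{ -1}\,0\,1,\quad { -1} \mapsto 0'\,{ -1}\,1\,{ -1},$$ and let $\zeta$ be the morphism on the same alphabet defined by $$0 \mapsto 0\,1\,0'\,{ -1},\quad 0' \mapsto 0\,1\,0'\,{ -1},\quad 1 \mapsto 0\,1\,{ -1}\,1\,0'\,{ -1},\quad { -1} \mapsto 1\,{ -1}.$$ Then (a) $\varphi^n \circ \zeta = \zeta^{n+1}$ for all $n \geq 0$; and (b) $\varphi^n(0) = \zeta^n(0)$ for all $n \geq 0$.
   Context: Morphisms are monoid homomorphisms on free monoids of words, determined by the images of letters; $\varphi^0$ and $\zeta^0$ are the identity. -}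

module Defs where

open import Data.Nat using (ℕ; zero; suc)
open import Data.List using (List; []; _∷_; concatMap)
open import Function using (_∘_; id)

data Letter : Set where
  a0 a1 a0' am1 : Letter

Word : Set
Word = List Letter

extend : (Letter → Word) → Word → Word
extend f = concatMap f

φl : Letter → Word
φl a0  = a0 ∷ a1 ∷ a0' ∷ am1 ∷ []
φl a1  = a0 ∷ a1 ∷ am1 ∷ a1 ∷ []
φl a0' = a0' ∷ am1 ∷ a0 ∷ a1 ∷ []
φl am1 = a0' ∷ am1 ∷ a1 ∷ am1 ∷ []

ζl : Letter → Word
ζl a0  = a0 ∷ a1 ∷ a0' ∷ am1 ∷ []
ζl a0' = a0 ∷ a1 ∷ a0' ∷ am1 ∷ []
ζl a1  = a0 ∷ a1 ∷ am1 ∷ a1 ∷ a0' ∷ am1 ∷ []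
ζl am1 = a1 ∷ am1 ∷ []

φ : Word → Word
φ = extend φl

ζ : Word → Word
ζ = extend ζl

iter : ℕ → (Word → Word) → Word → Word
iter zero    f = id
iter (suc n) f = f ∘ iter n f

-- Since morphisms compose letterwise, φ ∘ ζ = ζ ∘ ζ reduces to the four
-- finite checks φ(ζ x) = ζ(ζ x); part (a) follows by induction on n, and
-- part (b) from φ(0) = ζ(0) together with (a).
module Submission where

open import Defs
open import Data.Nat using (ℕ; suc; zero)
open import Data.List using ([]; _∷_)
open import Data.List.Properties using (concatMap-cong)
open import Data.List.Effectful using (module MonadProperties)
open import Data.Product using (_×_; _,_)
open import Function using (_∘_)
open import Relation.Binary.PropositionalEquality using (_≡_; _≗_; refl; cong; sym; trans; module ≡-Reasoning)
open ≡-Reasoning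

extend-∘ : (f g : Letter → Word) → extend g ∘ extend f ≗ extend (extend g ∘ f)
extend-∘ f g w = sym (MonadProperties.associative w f g)

iter-suc : (f : Word → Word) (n : ℕ) → iter n f ∘ f ≗ iter (suc n) f
iter-suc f zero    w = refl
iter-suc f (suc n) w = cong f (iter-suc f n w)

φ-ζl≡ζ-ζl : φ ∘ ζl ≗ ζ ∘ ζl
φ-ζl≡ζ-ζl a0  = refl
φ-ζl≡ζ-ζl a1  = refl
φ-ζl≡ζ-ζl a0' = refl
φ-ζl≡ζ-ζl am1 = refl

φ∘ζ≡ζ∘ζ : φ ∘ ζ ≗ ζ ∘ ζ
φ∘ζ≡ζ∘ζ w = begin
  φ (ζ w)                ≡⟨ extend-∘ ζl φl w ⟩
  extend (φ ∘ ζl) w      ≡⟨ concatMap-cong φ-ζl≡ζ-ζl w ⟩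
  extend (ζ ∘ ζl) w      ≡⟨ extend-∘ ζl ζl w ⟨
  ζ (ζ w)                ∎

φⁿ∘ζ≡ζⁿ⁺¹ : (n : ℕ) → iter n φ ∘ ζ ≗ iter (suc n) ζ
φⁿ∘ζ≡ζⁿ⁺¹ zero    w = refl
φⁿ∘ζ≡ζⁿ⁺¹ (suc n) w = trans (cong φ (φⁿ∘ζ≡ζⁿ⁺¹ n w)) (φ∘ζ≡ζ∘ζ (iter n ζ w))

lemma6 : ((n : ℕ) → (w : Word) → iter n φ (ζ w) ≡ iter (suc n) ζ w)
         × ((n : ℕ) → iter n φ (a0 ∷ []) ≡ iter n ζ (a0 ∷ []))
lemma6 = φⁿ∘ζ≡ζⁿ⁺¹ , fixedLetter
  where
  -- φ(0) = ζ(0) holds definitionally, so φⁿ⁺¹(0) = φⁿ(ζ(0)) = ζⁿ⁺¹(0).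
  fixedLetter : (n : ℕ) → iter n φ (a0 ∷ []) ≡ iter n ζ (a0 ∷ [])
  fixedLetter zero    = refl
  fixedLetter (suc n) = trans (sym (iter-suc φ n (a0 ∷ []))) (φⁿ∘ζ≡ζⁿ⁺¹ n (a0 ∷ []))
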